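{- Let $N=nm$ where $n,m$ are coprime natural numbers different from $1$, and suppose $m$ is odd and not divisible by $3$. Then there exists an integer $1\le k\le N-1$ coprime to $N$ such that the $\overline k$-monomial minimal solution of $(E_N)$ is reducible, and this solution has size $6m$ if $n>2$ and size $3m$ otherwise.
   Context: For an integer $N\ge 2$ and $a_1,\dots,a_n\in\mathbb{Z}/N\mathbb{Z}$, set $M_n(a_1,\dots,a_n)=\begin{pmatrix}a_n&-1\\1&0\end{pmatrix}\cdots\begin{pmatrix}a_1&-1\\1&0\end{pmatrix}\in SL_2(\mathbb{Z}/N\mathbb{Z})$. The equation $(E_N)$ is $M_n(a_1,\dots,a_n)=\pm \mathrm{Id}$; an $n$-tuple satisfying it is a solution of size $n$. Define $(a_1,\dots,a_n)\oplus(b_1,\dots,b_m)=(a_1+b_m,a_2,\dots,a_{n-1},a_n+b_1,b_2,\dots,b_{m-1})$, and $(a_1,\dots,a_n)\sim(b_1,\dots,b_n)$ if $(b_1,\dots,b_n)$ is a cyclic permutation of $(a_1,\dots,a_n)$ or of $(a_n,\dots,a_1)$. A solution $(c_1,\dots,c_n)$ of $(E_N)$ with $n\ge 3$ is reducible if there exist a solution $(b_1,\dots,b_l)$ of $(E_N)$ and an $m$-tuple $(a_1,\dots,a_m)$ with $m\ge3$, $l\ge 3$ and $(c_1,\dots,c_n)\sim(a_1,\dots,a_m)\oplus(b_1,\dots,b_l)$. The $\overline k$-monomial minimal solution of $(E_N)$ is $(\overline k,\dots,\overline k)$ of the least positive length for which it solves $(E_N)$. -}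

module Defs where

open import Data.Nat as ℕ using (ℕ; zero; suc)
open import Data.Integer as ℤ using (ℤ; +_; -_; _+_; _*_; _-_; 0ℤ; 1ℤ)
open import Data.Integer.Divisibility using (_∣_)
open import Data.List using (List; []; _∷_; _++_; drop; take; reverse; replicate; length)
open import Data.List.Relation.Binary.Pointwise using (Pointwise)
open import Data.Product using (Σ; ∃; ∃-syntax; _×_; _,_)
open import Data.Sum using (_⊎_)
open import Relation.Nullary using (¬_)

-- Elements of ℤ/Nℤ are represented by integers; equality in ℤ/Nℤ is
-- congruence modulo N.
_≡_[mod_] : ℤ → ℤ → ℕ → Set
x ≡ y [mod N ] = (+ N) ∣ (x - y)

record Mat : Set where
  constructor mat
  field
    m₁₁ m₁₂ m₂₁ m₂₂ : ℤ

_·_ : Mat → Mat → Mat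
mat a b c d · mat a' b' c' d' =
  mat (a * a' + b * c') (a * b' + b * d') (c * a' + d * c') (c * b' + d * d')

IdM : Mat
IdM = mat 1ℤ 0ℤ 0ℤ 1ℤ

A : ℤ → Mat
A a = mat a (- 1ℤ) 1ℤ 0ℤ

-- M (a₁ , … , aₙ) = A aₙ ⋯ A a₁
M : List ℤ → Mat
M []       = IdM
M (a ∷ as) = M as · A a

_≡M_[mod_] : Mat → Mat → ℕ → Set
mat a b c d ≡M mat a' b' c' d' [mod N ] =
  (a ≡ a' [mod N ]) × (b ≡ b' [mod N ]) × (c ≡ c' [mod N ]) × (d ≡ d' [mod N ])

negM : Mat → Mat
negM (mat a b c d) = mat (- a) (- b) (- c) (- d)

Solution : ℕ → List ℤ → Set
Solution N as = (M as ≡M IdM [mod N ]) ⊎ (M as ≡M negM IdM [mod N ])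

splitLast : ℤ → List ℤ → List ℤ × ℤ
splitLast x []       = [] , x
splitLast x (y ∷ ys) with splitLast y ys
... | i , l = x ∷ i , l

-- (a₁,…,aₙ) ⊕ (b₁,…,bₘ) = (a₁+bₘ, a₂,…,aₙ₋₁, aₙ+b₁, b₂,…,bₘ₋₁)
-- (only meaningful for n, m ≥ 2; returns [] otherwise)
_⊕_ : List ℤ → List ℤ → List ℤ
(a₁ ∷ a₂ ∷ as) ⊕ (b₁ ∷ b₂ ∷ bs) with splitLast a₂ as | splitLast b₂ bs
... | amid , aₙ | bmid , bₘ = (a₁ + bₘ) ∷ amid ++ ((aₙ + b₁) ∷ bmid)
_ ⊕ _ = []

rotate : ℕ → List ℤ → List ℤ
rotate i xs = drop i xs ++ take i xs

_≡L_[mod_] : List ℤ → List ℤ → ℕ → Set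
xs ≡L ys [mod N ] = Pointwise (λ x y → x ≡ y [mod N ]) xs ys

Equiv : ℕ → List ℤ → List ℤ → Set
Equiv N as bs = ∃[ i ] ((bs ≡L rotate i as [mod N ]) ⊎ (bs ≡L rotate i (reverse as) [mod N ]))

Reducible : ℕ → List ℤ → Set
Reducible N cs =
  3 ℕ.≤ length cs × Solution N cs ×
  (∃[ bs ] ∃[ as ] (Solution N bs × 3 ℕ.≤ length bs × 3 ℕ.≤ length as ×
                   Equiv N cs (as ⊕ bs)))

IsMonomialMinimalSize : ℕ → ℕ → ℕ → Set
IsMonomialMinimalSize N k L =
  1 ℕ.≤ L × Solution N (replicate L (+ k)) ×
  (∀ L' → 1 ℕ.≤ L' → L' ℕ.< L → ¬ Solution N (replicate L' (+ k)))

-- Take k ≡ 1 (mod n) and k ≡ 2 (mod m). Modulo m, (A 2)^L = Id + L (1 -1 ; 1 -1) is Id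
-- exactly when m ∣ L and is never -Id since m ∤ 2; modulo n, A 1 has order c = 6
-- (c = 3 when n = 2, where -Id = Id) and (A 1)^3 = -Id. So the k̄-monomial minimal
-- solution has size c m. With f = 2 - k (≡ 1 mod n, ≡ 0 mod m) it splits as
-- (k - f, k, …, k, k - f) ⊕ (f, k, …, k, f), where the second tuple, with j + 1 middle
-- entries, is a solution as soon as c ∣ j (it is (A 1)^(j+3) = -Id modulo n) and
-- m ∣ j + 1 (it is A 0 (A 2)^(j+1) A 0 = -Id modulo m). Since m ≡ ±1 modulo 6, hence
-- modulo 3, j + 1 = m or (c - 1) m works and leaves room for the first tuple.

module Submission where

open import Defs
open import Data.Nat as ℕ
  using (ℕ; zero; suc; _*_; _+_; _∸_; _≤_; _<_; _>_; s≤s; z≤n; NonZero; >-nonZero; >-nonZero⁻¹)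
import Data.Nat.Properties as ℕ
import Data.Nat.Tactic.RingSolver as ℕ-Solver
open import Data.Nat.DivMod using (_%_; _/_; m%n<n; m≡m%n+[m/n]*n)
open import Data.Nat.Divisibility
  using (_∣_; divides; divides-refl; ∣⇒≤; ∣-refl; ∣-reflexive; ∣-trans; _∣0; 1∣_; ∣1⇒≡1; ∣m+n∣m⇒∣n; m∣m*n; n∣m*n)
open import Data.Nat.Coprimality using (Coprime; coprime-Bézout; coprime-divisor; coprime⇒gcd≡1; 1-coprimeTo)
open import Data.Nat.GCD using (module Bézout)
open import Data.Nat.LCM using (lcm; lcm-least; gcd*lcm)
open import Data.Nat.Primality using (prime⇒irreducible; prime[2])
open import Data.Integer as ℤ using (ℤ; +_; -_; 0ℤ; 1ℤ)
import Data.Integer.Properties as ℤ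
open import Data.Integer.DivMod using (_%ℕ_; _/ℕ_; n%ℕd<d; a≡a%ℕn+[a/ℕn]*n)
open import Data.Integer.Divisibility.Signed as ℤ∣ using (divides; ∣ᵤ⇒∣; ∣⇒∣ᵤ) renaming (_∣_ to _∣ℤ_)
open import Data.Integer.Tactic.RingSolver using (solve-∀)
open import Data.List using (List; []; _∷_; _∷ʳ_; _++_; replicate; length)
open import Data.List.Properties using (length-replicate; length-++; ++-identityʳ)
import Data.List.Relation.Binary.Pointwise as Pointwise
open Pointwise using (Pointwise; []; _∷_)
open import Data.Product using (_×_; _,_; proj₁; proj₂; ∃-syntax)
open import Data.Sum using (_⊎_; inj₁; inj₂)
open import Data.Empty using (⊥-elim)
open import Function.Bundles using (_⇔_; mk⇔; Equivalence)
open import Relation.Binary.Bundles using (Setoid)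
open import Relation.Binary.Structures using (IsEquivalence)
open import Relation.Binary.PropositionalEquality
import Relation.Binary.Reasoning.Setoid as SetoidReasoning
open import Relation.Nullary using (¬_)
open Mat

coprime⇒*∣ : ∀ {n m a} → Coprime n m → n ∣ a → m ∣ a → n * m ∣ a
coprime⇒*∣ {n} {m} cop n∣a m∣a = subst (_∣ _) lcm≡n*m (lcm-least n∣a m∣a)
  where
  lcm≡n*m : lcm n m ≡ n * m
  lcm≡n*m = trans (sym (ℕ.*-identityˡ _)) (subst (λ g → g * lcm n m ≡ n * m) (coprime⇒gcd≡1 cop) (gcd*lcm n m))

-- A record wrapper around _≡_[mod_], so that Agda can infer both sides and the modulus.
infix 4 _≅_[mod_]
record _≅_[mod_] (x y : ℤ) (N : ℕ) : Set where
  constructor modulo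
  field divides-diff : + N ∣ℤ x ℤ.- y
open _≅_[mod_] public

module _ {N : ℕ} where

  ≅-by : ∀ {x y} z → x ℤ.- y ≡ z → + N ∣ℤ z → x ≅ y [mod N ]
  ≅-by z x-y≡z N∣z = modulo (subst (+ N ∣ℤ_) (sym x-y≡z) N∣z)

  ≅-refl : ∀ {x} → x ≅ x [mod N ]
  ≅-refl {x} = ≅-by 0ℤ (x-x≡0 x) (divides 0ℤ refl)
    where
    x-x≡0 : ∀ x → x ℤ.- x ≡ 0ℤ
    x-x≡0 = solve-∀

  ≅-sym : ∀ {x y} → x ≅ y [mod N ] → y ≅ x [mod N ]
  ≅-sym {x} {y} (modulo d) = ≅-by _ (y-x≡-[x-y] x y) (ℤ∣.∣m⇒∣-m d)
    where
    y-x≡-[x-y] : ∀ x y → y ℤ.- x ≡ - (x ℤ.- y)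
    y-x≡-[x-y] = solve-∀

  ≅-trans : ∀ {x y z} → x ≅ y [mod N ] → y ≅ z [mod N ] → x ≅ z [mod N ]
  ≅-trans {x} {y} {z} (modulo d) (modulo e) = ≅-by _ (telescope x y z) (ℤ∣.∣m∣n⇒∣m+n d e)
    where
    telescope : ∀ x y z → x ℤ.- z ≡ (x ℤ.- y) ℤ.+ (y ℤ.- z)
    telescope = solve-∀

  +-cong : ∀ {x x′ y y′} → x ≅ x′ [mod N ] → y ≅ y′ [mod N ] → x ℤ.+ y ≅ x′ ℤ.+ y′ [mod N ]
  +-cong {x} {x′} {y} {y′} (modulo d) (modulo e) = ≅-by _ (split x x′ y y′) (ℤ∣.∣m∣n⇒∣m+n d e)
    where
    split : ∀ x x′ y y′ → (x ℤ.+ y) ℤ.- (x′ ℤ.+ y′) ≡ (x ℤ.- x′) ℤ.+ (y ℤ.- y′)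
    split = solve-∀

  *-cong : ∀ {x x′ y y′} → x ≅ x′ [mod N ] → y ≅ y′ [mod N ] → x ℤ.* y ≅ x′ ℤ.* y′ [mod N ]
  *-cong {x} {x′} {y} {y′} (modulo d) (modulo e) =
    ≅-by _ (split x x′ y y′) (ℤ∣.∣m∣n⇒∣m+n (ℤ∣.∣n⇒∣m*n x e) (ℤ∣.∣n⇒∣m*n y′ d))
    where
    split : ∀ x x′ y y′ → x ℤ.* y ℤ.- x′ ℤ.* y′ ≡ x ℤ.* (y ℤ.- y′) ℤ.+ y′ ℤ.* (x ℤ.- x′)
    split = solve-∀

  -‿cong : ∀ {x x′} → x ≅ x′ [mod N ] → - x ≅ - x′ [mod N ]
  -‿cong {x} {x′} (modulo d) = ≅-by _ (split x x′) (ℤ∣.∣m⇒∣-m d)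
    where
    split : ∀ x x′ → - x ℤ.- - x′ ≡ - (x ℤ.- x′)
    split = solve-∀

  ≅⇒≡[mod] : ∀ {x y} → x ≅ y [mod N ] → x ≡ y [mod N ]
  ≅⇒≡[mod] (modulo d) = ∣⇒∣ᵤ d

  ≡[mod]⇒≅ : ∀ {x y} → x ≡ y [mod N ] → x ≅ y [mod N ]
  ≡[mod]⇒≅ d = modulo (∣ᵤ⇒∣ d)

≅-divisor : ∀ {d N x y} → d ∣ N → x ≅ y [mod N ] → x ≅ y [mod d ]
≅-divisor d∣N (modulo e) = modulo (ℤ∣.∣-trans (∣ᵤ⇒∣ d∣N) e)

≅-combine : ∀ {n m x y} → Coprime n m → x ≅ y [mod n ] → x ≅ y [mod m ] → x ≅ y [mod n * m ]
≅-combine cop (modulo d) (modulo e) = modulo (∣ᵤ⇒∣ (coprime⇒*∣ cop (∣⇒∣ᵤ d) (∣⇒∣ᵤ e)))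

≅-reflexive : ∀ {N x y} → x ≡ y → x ≅ y [mod N ]
≅-reflexive refl = ≅-refl

≅0⇒∣ : ∀ {N a} → + a ≅ 0ℤ [mod N ] → N ∣ a
≅0⇒∣ {N} {a} a≅0 = subst (N ∣_) (ℕ.+-identityʳ a) (≅⇒≡[mod] a≅0)


infix 4 _≅ᴹ_[mod_]
record _≅ᴹ_[mod_] (X Y : Mat) (N : ℕ) : Set where
  constructor entrywise
  field
    at₁₁ : m₁₁ X ≅ m₁₁ Y [mod N ]
    at₁₂ : m₁₂ X ≅ m₁₂ Y [mod N ]
    at₂₁ : m₂₁ X ≅ m₂₁ Y [mod N ]
    at₂₂ : m₂₂ X ≅ m₂₂ Y [mod N ]
open _≅ᴹ_[mod_] public

module _ {N : ℕ} where

  ≅ᴹ-reflexive : ∀ {X Y} → X ≡ Y → X ≅ᴹ Y [mod N ]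
  ≅ᴹ-reflexive refl = entrywise ≅-refl ≅-refl ≅-refl ≅-refl

  ≅ᴹ-sym : ∀ {X Y} → X ≅ᴹ Y [mod N ] → Y ≅ᴹ X [mod N ]
  ≅ᴹ-sym (entrywise a b c d) = entrywise (≅-sym a) (≅-sym b) (≅-sym c) (≅-sym d)

  ≅ᴹ-trans : ∀ {X Y Z} → X ≅ᴹ Y [mod N ] → Y ≅ᴹ Z [mod N ] → X ≅ᴹ Z [mod N ]
  ≅ᴹ-trans (entrywise a b c d) (entrywise a′ b′ c′ d′) =
    entrywise (≅-trans a a′) (≅-trans b b′) (≅-trans c c′) (≅-trans d d′)

  ≅ᴹ-isEquivalence : IsEquivalence (λ X Y → X ≅ᴹ Y [mod N ])
  ≅ᴹ-isEquivalence = record { refl = ≅ᴹ-reflexive refl ; sym = ≅ᴹ-sym ; trans = ≅ᴹ-trans }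

  ≅ᴹ-setoid : Setoid _ _
  ≅ᴹ-setoid = record { isEquivalence = ≅ᴹ-isEquivalence }

  ·-cong : ∀ {X X′ Y Y′} → X ≅ᴹ X′ [mod N ] → Y ≅ᴹ Y′ [mod N ] → X · Y ≅ᴹ X′ · Y′ [mod N ]
  ·-cong (entrywise a b c d) (entrywise a′ b′ c′ d′) = entrywise
    (+-cong (*-cong a a′) (*-cong b c′)) (+-cong (*-cong a b′) (*-cong b d′))
    (+-cong (*-cong c a′) (*-cong d c′)) (+-cong (*-cong c b′) (*-cong d d′))

  ·-congˡ : ∀ X {Y Y′} → Y ≅ᴹ Y′ [mod N ] → X · Y ≅ᴹ X · Y′ [mod N ]
  ·-congˡ X = ·-cong (≅ᴹ-reflexive {X} refl)

  ·-congʳ : ∀ {X X′} Y → X ≅ᴹ X′ [mod N ] → X · Y ≅ᴹ X′ · Y [mod N ]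
  ·-congʳ Y X≅X′ = ·-cong X≅X′ (≅ᴹ-reflexive {Y} refl)

  negM-cong : ∀ {X Y} → X ≅ᴹ Y [mod N ] → negM X ≅ᴹ negM Y [mod N ]
  negM-cong (entrywise a b c d) = entrywise (-‿cong a) (-‿cong b) (-‿cong c) (-‿cong d)

  M-cong : ∀ {xs ys} → Pointwise (λ x y → x ≅ y [mod N ]) xs ys → M xs ≅ᴹ M ys [mod N ]
  M-cong []       = ≅ᴹ-reflexive refl
  M-cong (x≅y ∷ xs≅ys) = ·-cong (M-cong xs≅ys) (entrywise x≅y ≅-refl ≅-refl ≅-refl)

  ≅ᴹ⇒≡M : ∀ {X Y} → X ≅ᴹ Y [mod N ] → X ≡M Y [mod N ]
  ≅ᴹ⇒≡M (entrywise a b c d) = ≅⇒≡[mod] a , ≅⇒≡[mod] b , ≅⇒≡[mod] c , ≅⇒≡[mod] d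

  ≡M⇒≅ᴹ : ∀ {X Y} → X ≡M Y [mod N ] → X ≅ᴹ Y [mod N ]
  ≡M⇒≅ᴹ (a , b , c , d) = entrywise (≡[mod]⇒≅ a) (≡[mod]⇒≅ b) (≡[mod]⇒≅ c) (≡[mod]⇒≅ d)

≅ᴹ-divisor : ∀ {d N X Y} → d ∣ N → X ≅ᴹ Y [mod N ] → X ≅ᴹ Y [mod d ]
≅ᴹ-divisor d∣N (entrywise a b c e) =
  entrywise (≅-divisor d∣N a) (≅-divisor d∣N b) (≅-divisor d∣N c) (≅-divisor d∣N e)

≅ᴹ-combine : ∀ {n m X Y} → Coprime n m → X ≅ᴹ Y [mod n ] → X ≅ᴹ Y [mod m ] → X ≅ᴹ Y [mod n * m ]
≅ᴹ-combine cop (entrywise a b c d) (entrywise a′ b′ c′ d′) =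
  entrywise (≅-combine cop a a′) (≅-combine cop b b′) (≅-combine cop c c′) (≅-combine cop d d′)

mat-≡ : ∀ {a b c d a′ b′ c′ d′} → a ≡ a′ → b ≡ b′ → c ≡ c′ → d ≡ d′ → mat a b c d ≡ mat a′ b′ c′ d′
mat-≡ refl refl refl refl = refl

·-assoc : ∀ X Y Z → (X · Y) · Z ≡ X · (Y · Z)
·-assoc (mat a b c d) (mat p q r s) (mat x y z w) =
  mat-≡ (entry a b p q r s x z) (entry a b p q r s y w) (entry c d p q r s x z) (entry c d p q r s y w)
  where
  entry : ∀ u₁ u₂ p q r s v₁ v₂ →
    (u₁ ℤ.* p ℤ.+ u₂ ℤ.* r) ℤ.* v₁ ℤ.+ (u₁ ℤ.* q ℤ.+ u₂ ℤ.* s) ℤ.* v₂ ≡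
    u₁ ℤ.* (p ℤ.* v₁ ℤ.+ q ℤ.* v₂) ℤ.+ u₂ ℤ.* (r ℤ.* v₁ ℤ.+ s ℤ.* v₂)
  entry = solve-∀

·-identityˡ : ∀ X → IdM · X ≡ X
·-identityˡ (mat a b c d) = mat-≡ (unit a c) (unit b d) (unit′ c a) (unit′ d b)
  where
  unit : ∀ u v → 1ℤ ℤ.* u ℤ.+ 0ℤ ℤ.* v ≡ u
  unit = solve-∀
  unit′ : ∀ u v → 0ℤ ℤ.* v ℤ.+ 1ℤ ℤ.* u ≡ u
  unit′ = solve-∀

·-identityʳ : ∀ X → X · IdM ≡ X
·-identityʳ (mat a b c d) = mat-≡ (unit a b) (unit′ b a) (unit c d) (unit′ d c)
  where
  unit : ∀ u v → u ℤ.* 1ℤ ℤ.+ v ℤ.* 0ℤ ≡ u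
  unit = solve-∀
  unit′ : ∀ u v → v ℤ.* 0ℤ ℤ.+ u ℤ.* 1ℤ ≡ u
  unit′ = solve-∀

M-∷ʳ : ∀ xs x → M (xs ∷ʳ x) ≡ A x · M xs
M-∷ʳ []       x = trans (·-identityˡ (A x)) (sym (·-identityʳ (A x)))
M-∷ʳ (y ∷ ys) x = trans (cong (_· A y) (M-∷ʳ ys x)) (·-assoc (A x) (M ys) (A y))

A₁^ : ℕ → Mat
A₁^ 0 = IdM
A₁^ 1 = A 1ℤ
A₁^ 2 = mat 0ℤ (- 1ℤ) 1ℤ (- 1ℤ)
A₁^ 3 = negM IdM
A₁^ 4 = negM (A 1ℤ)
A₁^ 5 = negM (mat 0ℤ (- 1ℤ) 1ℤ (- 1ℤ))
A₁^ (suc (suc (suc (suc (suc (suc L)))))) = A₁^ L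

A₁^-suc : ∀ L → A₁^ L · A 1ℤ ≡ A₁^ (suc L)
A₁^-suc 0 = refl
A₁^-suc 1 = refl
A₁^-suc 2 = refl
A₁^-suc 3 = refl
A₁^-suc 4 = refl
A₁^-suc 5 = refl
A₁^-suc (suc (suc (suc (suc (suc (suc L)))))) = A₁^-suc L

M-replicate-1 : ∀ L → M (replicate L 1ℤ) ≡ A₁^ L
M-replicate-1 zero    = refl
M-replicate-1 (suc L) = trans (cong (_· A 1ℤ) (M-replicate-1 L)) (A₁^-suc L)

A₁^-periodic : ∀ q r → A₁^ (q * 6 + r) ≡ A₁^ r
A₁^-periodic zero    r = refl
A₁^-periodic (suc q) r = A₁^-periodic q r

A₁^-3+ : ∀ L → A₁^ (3 + L) ≡ negM (A₁^ L)
A₁^-3+ 0 = refl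
A₁^-3+ 1 = refl
A₁^-3+ 2 = refl
A₁^-3+ 3 = refl
A₁^-3+ 4 = refl
A₁^-3+ 5 = refl
A₁^-3+ (suc (suc (suc (suc (suc (suc L)))))) = A₁^-3+ L

A₁^≅Id⇒ : ∀ {n} L → A₁^ L ≅ᴹ IdM [mod n ] → 6 ∣ L ⊎ (3 ∣ L × n ∣ 2) ⊎ n ∣ 1
A₁^≅Id⇒ {n} L A₁^L≅Id = by-residue (L % 6) (m%n<n L 6) L≡q*6+r
  (subst (λ X → X ≅ᴹ IdM [mod n ]) (trans (cong A₁^ L≡q*6+r) (A₁^-periodic q (L % 6))) A₁^L≅Id)
  where
  q = L / 6
  L≡q*6+r : L ≡ q * 6 + L % 6
  L≡q*6+r = trans (m≡m%n+[m/n]*n L 6) (ℕ.+-comm (L % 6) (q * 6))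
  by-residue : ∀ r → r < 6 → L ≡ q * 6 + r → A₁^ r ≅ᴹ IdM [mod n ] → 6 ∣ L ⊎ (3 ∣ L × n ∣ 2) ⊎ n ∣ 1
  by-residue 0 _ L≡ _ = inj₁ (divides q (trans L≡ (ℕ.+-identityʳ (q * 6))))
  by-residue 1 _ _  e = inj₂ (inj₂ (≅⇒≡[mod] (at₂₁ e)))
  by-residue 2 _ _  e = inj₂ (inj₂ (≅⇒≡[mod] (at₂₁ e)))
  by-residue 3 _ L≡ e = inj₂ (inj₁ (divides (q * 2 + 1) (trans L≡ (q*6+3 q)) , ≅⇒≡[mod] (at₁₁ e)))
    where
    q*6+3 : ∀ q → q * 6 + 3 ≡ (q * 2 + 1) * 3
    q*6+3 = ℕ-Solver.solve-∀
  by-residue 4 _ _  e = inj₂ (inj₂ (≅⇒≡[mod] (at₂₁ e)))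
  by-residue 5 _ _  e = inj₂ (inj₂ (≅⇒≡[mod] (at₂₁ e)))
  by-residue (suc (suc (suc (suc (suc (suc _)))))) (s≤s (s≤s (s≤s (s≤s (s≤s (s≤s ())))))) _ _

OrderA₁ : ℕ → ℕ → Set
OrderA₁ n c = ∀ L → A₁^ L ≅ᴹ IdM [mod n ] ⇔ c ∣ L

order-6 : ∀ {n} → ¬ n ∣ 2 → OrderA₁ n 6
order-6 {n} n∤2 L = mk⇔ to from
  where
  to : A₁^ L ≅ᴹ IdM [mod n ] → 6 ∣ L
  to e with A₁^≅Id⇒ L e
  ... | inj₁ 6∣L             = 6∣L
  ... | inj₂ (inj₁ (_ , n∣2)) = ⊥-elim (n∤2 n∣2)
  ... | inj₂ (inj₂ n∣1)       = ⊥-elim (n∤2 (∣-trans n∣1 (1∣ 2)))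
  from : 6 ∣ L → A₁^ L ≅ᴹ IdM [mod n ]
  from (divides-refl q) = ≅ᴹ-reflexive (trans (cong A₁^ (sym (ℕ.+-identityʳ (q * 6)))) (A₁^-periodic q 0))

-Id≅Id[mod2] : negM IdM ≅ᴹ IdM [mod 2 ]
-Id≅Id[mod2] = entrywise (modulo (divides (- 1ℤ) refl)) ≅-refl ≅-refl (modulo (divides (- 1ℤ) refl))

order-3-mod-2 : OrderA₁ 2 3
order-3-mod-2 L = mk⇔ to from
  where
  to : A₁^ L ≅ᴹ IdM [mod 2 ] → 3 ∣ L
  to e with A₁^≅Id⇒ L e
  ... | inj₁ 6∣L       = ∣-trans (divides 2 refl) 6∣L
  ... | inj₂ (inj₁ (3∣L , _)) = 3∣L
  ... | inj₂ (inj₂ (divides zero ()))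
  ... | inj₂ (inj₂ (divides (suc _) ()))
  A₁^-*3 : ∀ q → A₁^ (q * 3) ≅ᴹ IdM [mod 2 ]
  A₁^-*3 zero    = ≅ᴹ-reflexive refl
  A₁^-*3 (suc q) = begin
    A₁^ (3 + q * 3)    ≡⟨ A₁^-3+ (q * 3) ⟩
    negM (A₁^ (q * 3)) ≈⟨ negM-cong (A₁^-*3 q) ⟩
    negM IdM           ≈⟨ -Id≅Id[mod2] ⟩
    IdM                ∎
    where open SetoidReasoning ≅ᴹ-setoid
  from : 3 ∣ L → A₁^ L ≅ᴹ IdM [mod 2 ]
  from (divides-refl q) = A₁^-*3 q

order⇒A₁^3+≅-Id : ∀ {n c j} → OrderA₁ n c → c ∣ j → A₁^ (3 + j) ≅ᴹ negM IdM [mod n ]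
order⇒A₁^3+≅-Id {n} {c} {j} order c∣j = begin
  A₁^ (3 + j)    ≡⟨ A₁^-3+ j ⟩
  negM (A₁^ j)   ≈⟨ negM-cong (Equivalence.from (order j) c∣j) ⟩
  negM IdM       ∎
  where open SetoidReasoning ≅ᴹ-setoid

A₂-power : ℤ → Mat
A₂-power t = mat (t ℤ.+ 1ℤ) (- t) t (1ℤ ℤ.- t)

A₂-power-suc : ∀ t → A₂-power t · A (+ 2) ≡ A₂-power (1ℤ ℤ.+ t)
A₂-power-suc t = mat-≡ (e₁₁ t) (e₁₂ t) (e₂₁ t) (e₂₂ t)
  where
  e₁₁ : ∀ t → (t ℤ.+ 1ℤ) ℤ.* + 2 ℤ.+ (- t) ℤ.* 1ℤ ≡ (1ℤ ℤ.+ t) ℤ.+ 1ℤ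
  e₁₁ = solve-∀
  e₁₂ : ∀ t → (t ℤ.+ 1ℤ) ℤ.* - 1ℤ ℤ.+ (- t) ℤ.* 0ℤ ≡ - (1ℤ ℤ.+ t)
  e₁₂ = solve-∀
  e₂₁ : ∀ t → t ℤ.* + 2 ℤ.+ (1ℤ ℤ.- t) ℤ.* 1ℤ ≡ 1ℤ ℤ.+ t
  e₂₁ = solve-∀
  e₂₂ : ∀ t → t ℤ.* - 1ℤ ℤ.+ (1ℤ ℤ.- t) ℤ.* 0ℤ ≡ 1ℤ ℤ.- (1ℤ ℤ.+ t)
  e₂₂ = solve-∀

M-replicate-2 : ∀ L → M (replicate L (+ 2)) ≡ A₂-power (+ L)
M-replicate-2 zero    = refl
M-replicate-2 (suc L) = begin
  M (replicate L (+ 2)) · A (+ 2) ≡⟨ cong (_· A (+ 2)) (M-replicate-2 L) ⟩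
  A₂-power (+ L) · A (+ 2)        ≡⟨ A₂-power-suc (+ L) ⟩
  A₂-power (1ℤ ℤ.+ + L)           ≡⟨ cong A₂-power (sym (ℤ.pos-+ 1 L)) ⟩
  A₂-power (+ suc L)              ∎
  where open ≡-Reasoning

A₂-power≅Id : ∀ {N L} → N ∣ L → A₂-power (+ L) ≅ᴹ IdM [mod N ]
A₂-power≅Id {N} {L} N∣L = entrywise
  (≅-by _ (e₁₁ (+ L)) t) (≅-by _ (e₁₂ (+ L)) -t) (≅-by _ (e₂₁ (+ L)) t) (≅-by _ (e₂₂ (+ L)) -t)
  where
  t = ∣ᵤ⇒∣ N∣L
  -t = ℤ∣.∣m⇒∣-m t
  e₁₁ : ∀ t → (t ℤ.+ 1ℤ) ℤ.- 1ℤ ≡ t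
  e₁₁ = solve-∀
  e₁₂ : ∀ t → - t ℤ.- 0ℤ ≡ - t
  e₁₂ = solve-∀
  e₂₁ : ∀ t → t ℤ.- 0ℤ ≡ t
  e₂₁ = solve-∀
  e₂₂ : ∀ t → (1ℤ ℤ.- t) ℤ.- 1ℤ ≡ - t
  e₂₂ = solve-∀

A₂-power≅Id⇒∣ : ∀ {N L} → A₂-power (+ L) ≅ᴹ IdM [mod N ] → N ∣ L
A₂-power≅Id⇒∣ e = ≅0⇒∣ (at₂₁ e)

A₂-power≅-Id⇒∣2 : ∀ {N L} → A₂-power (+ L) ≅ᴹ negM IdM [mod N ] → N ∣ 2
A₂-power≅-Id⇒∣2 {N} {L} e =
  ≅⇒≡[mod] (≅-trans (≅-reflexive (sym ([t+1]-t≡1 (+ L)))) (+-cong (at₁₁ e) (-‿cong (at₂₁ e))))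
  where
  [t+1]-t≡1 : ∀ t → (t ℤ.+ 1ℤ) ℤ.+ - t ≡ 1ℤ
  [t+1]-t≡1 = solve-∀

replicate-+ : ∀ {A : Set} m n (x : A) → replicate (m + n) x ≡ replicate m x ++ replicate n x
replicate-+ zero    n x = refl
replicate-+ (suc m) n x = cong (x ∷_) (replicate-+ m n x)

splitLast-∷ʳ : ∀ x xs y → splitLast x (xs ∷ʳ y) ≡ (x ∷ xs , y)
splitLast-∷ʳ x []       y = refl
splitLast-∷ʳ x (z ∷ zs) y rewrite splitLast-∷ʳ z zs y = refl

⊕-∷ʳ : ∀ a₁ a₂ as aₙ b₁ b₂ bs bₘ →
  (a₁ ∷ (a₂ ∷ as) ∷ʳ aₙ) ⊕ (b₁ ∷ (b₂ ∷ bs) ∷ʳ bₘ) ≡ (a₁ ℤ.+ bₘ) ∷ (a₂ ∷ as) ++ (aₙ ℤ.+ b₁) ∷ b₂ ∷ bs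
⊕-∷ʳ a₁ a₂ as aₙ b₁ b₂ bs bₘ rewrite splitLast-∷ʳ a₂ as aₙ | splitLast-∷ʳ b₂ bs bₘ = refl

bordered : ℤ → ℕ → ℤ → List ℤ
bordered e s x = e ∷ replicate s x ∷ʳ e

length-bordered : ∀ e s x → length (bordered e s x) ≡ 2 + s
length-bordered e s x =
  cong suc (trans (length-++ (replicate s x)) (trans (cong (_+ 1) (length-replicate s)) (ℕ.+-comm s 1)))

bordered-replicate : ∀ s x → bordered x s x ≡ replicate (2 + s) x
bordered-replicate s x = cong (x ∷_) (trans (sym (replicate-+ s 1 x)) (cong (λ l → replicate l x) (ℕ.+-comm s 1)))

bordered-⊕ : ∀ e f i j x →
  bordered e (suc i) x ⊕ bordered f (suc j) x ≡ (e ℤ.+ f) ∷ replicate (suc i) x ++ (e ℤ.+ f) ∷ replicate (suc j) x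
bordered-⊕ e f i j x = ⊕-∷ʳ e x (replicate i x) e f x (replicate j x) f

bordered-⊕-complement : ∀ K f i j →
  bordered (K ℤ.- f) (suc i) K ⊕ bordered f (suc j) K ≡ replicate (suc (suc i) + suc (suc j)) K
bordered-⊕-complement K f i j = begin
  bordered (K ℤ.- f) (suc i) K ⊕ bordered f (suc j) K
    ≡⟨ bordered-⊕ (K ℤ.- f) f i j K ⟩
  (K ℤ.- f ℤ.+ f) ∷ replicate (suc i) K ++ (K ℤ.- f ℤ.+ f) ∷ replicate (suc j) K
    ≡⟨ cong (λ y → y ∷ replicate (suc i) K ++ y ∷ replicate (suc j) K) (K-f+f≡K K f) ⟩
  replicate (suc (suc i)) K ++ replicate (suc (suc j)) K
    ≡⟨ replicate-+ (suc (suc i)) (suc (suc j)) K ⟨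
  replicate (suc (suc i) + suc (suc j)) K ∎
  where
  open ≡-Reasoning
  K-f+f≡K : ∀ K f → K ℤ.- f ℤ.+ f ≡ K
  K-f+f≡K = solve-∀

Equiv-refl : ∀ N cs → Equiv N cs cs
Equiv-refl N cs =
  0 , inj₁ (subst (Pointwise _ cs) (sym (++-identityʳ cs)) (Pointwise.refl (λ {x} → ≅⇒≡[mod] (≅-refl {N} {x}))))

reducible-if-bordered : ∀ {N K L} f j → j + 4 ≤ L →
  Solution N (replicate L K) → Solution N (bordered f (suc j) K) → Reducible N (replicate L K)
reducible-if-bordered {N} {K} {L} f j j+4≤L sol-L sol-b =
  3≤L , sol-L , bordered f (suc j) K , bordered (K ℤ.- f) (suc i) K ,
  sol-b , 3≤bordered f j , 3≤bordered (K ℤ.- f) i ,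
  subst (Equiv N (replicate L K)) (sym split) (Equiv-refl N (replicate L K))
  where
  i = L ∸ (j + 4)
  L≡ : suc (suc i) + suc (suc j) ≡ L
  L≡ = trans (shuffle i j) (ℕ.m+[n∸m]≡n j+4≤L)
    where
    shuffle : ∀ i j → suc (suc i) + suc (suc j) ≡ j + 4 + i
    shuffle = ℕ-Solver.solve-∀
  split : bordered (K ℤ.- f) (suc i) K ⊕ bordered f (suc j) K ≡ replicate L K
  split = trans (bordered-⊕-complement K f i j) (cong (λ l → replicate l K) L≡)
  3≤L : 3 ≤ length (replicate L K)
  3≤L = subst (3 ≤_) (sym (length-replicate L)) (ℕ.≤-trans (s≤s (s≤s (s≤s z≤n))) (ℕ.m+n≤o⇒n≤o j j+4≤L))
  3≤bordered : ∀ e s → 3 ≤ length (bordered e (suc s) K)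
  3≤bordered e s = subst (3 ≤_) (sym (length-bordered e (suc s) K)) (s≤s (s≤s (s≤s z≤n)))

bordered-cong : ∀ {N e e′ x x′} s → e ≅ e′ [mod N ] → x ≅ x′ [mod N ] →
  Pointwise (λ a b → a ≅ b [mod N ]) (bordered e s x) (bordered e′ s x′)
bordered-cong s e≅e′ x≅x′ = e≅e′ ∷ Pointwise.++⁺ (Pointwise.replicate⁺ x≅x′ s) (e≅e′ ∷ [])

M-bordered : ∀ e s x → M (bordered e s x) ≡ (A e · M (replicate s x)) · A e
M-bordered e s x = cong (_· A e) (M-∷ʳ (replicate s x) e)

module MonomialSolutions {n m : ℕ} (n⊥m : Coprime n m) (3≤m : 3 ≤ m) {k : ℕ}
                         (k≅1 : + k ≅ 1ℤ [mod n ]) (k≅2 : + k ≅ + 2 [mod m ]) where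

  private
    K : ℤ
    K = + k

    m∤2 : ¬ m ∣ 2
    m∤2 m∣2 = ℕ.<⇒≱ 3≤m (∣⇒≤ m∣2)

    instance
      m≢0 : NonZero m
      m≢0 = >-nonZero (ℕ.≤-trans (s≤s z≤n) 3≤m)

  M-monomial-mod-n : ∀ L → M (replicate L K) ≅ᴹ A₁^ L [mod n ]
  M-monomial-mod-n L = begin
    M (replicate L K)  ≈⟨ M-cong (Pointwise.replicate⁺ k≅1 L) ⟩
    M (replicate L 1ℤ) ≡⟨ M-replicate-1 L ⟩
    A₁^ L              ∎
    where open SetoidReasoning ≅ᴹ-setoid

  M-monomial-mod-m : ∀ L → M (replicate L K) ≅ᴹ A₂-power (+ L) [mod m ]
  M-monomial-mod-m L = begin
    M (replicate L K)     ≈⟨ M-cong (Pointwise.replicate⁺ k≅2 L) ⟩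
    M (replicate L (+ 2)) ≡⟨ M-replicate-2 L ⟩
    A₂-power (+ L)        ∎
    where open SetoidReasoning ≅ᴹ-setoid

  private
    mod-n : ∀ {L X} → M (replicate L K) ≅ᴹ X [mod n * m ] → A₁^ L ≅ᴹ X [mod n ]
    mod-n {L} e = ≅ᴹ-trans (≅ᴹ-sym (M-monomial-mod-n L)) (≅ᴹ-divisor (m∣m*n m) e)

    mod-m : ∀ {L X} → M (replicate L K) ≅ᴹ X [mod n * m ] → A₂-power (+ L) ≅ᴹ X [mod m ]
    mod-m {L} e = ≅ᴹ-trans (≅ᴹ-sym (M-monomial-mod-m L)) (≅ᴹ-divisor (n∣m*n n) e)

  -- Modulo m, (A 2)^L is never -Id, so only the sign +Id can occur.
  solution⇒ : ∀ L → Solution (n * m) (replicate L K) → m ∣ L × A₁^ L ≅ᴹ IdM [mod n ]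
  solution⇒ L (inj₁ M≡Id)  = A₂-power≅Id⇒∣ (mod-m M≅Id) , mod-n M≅Id
    where M≅Id = ≡M⇒≅ᴹ {X = M (replicate L K)} M≡Id
  solution⇒ L (inj₂ M≡-Id) = ⊥-elim (m∤2 (A₂-power≅-Id⇒∣2 (mod-m (≡M⇒≅ᴹ {X = M (replicate L K)} M≡-Id))))

  solution⇐ : ∀ {L} → m ∣ L → A₁^ L ≅ᴹ IdM [mod n ] → Solution (n * m) (replicate L K)
  solution⇐ {L} m∣L A₁^L≅Id = inj₁ (≅ᴹ⇒≡M (≅ᴹ-combine n⊥m
    (≅ᴹ-trans (M-monomial-mod-n L) A₁^L≅Id) (≅ᴹ-trans (M-monomial-mod-m L) (A₂-power≅Id m∣L))))

  monomial-minimal-size : ∀ {c} .{{_ : NonZero c}} → OrderA₁ n c → Coprime c m →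
                          IsMonomialMinimalSize (n * m) k (c * m)
  monomial-minimal-size {c} order c⊥m =
    >-nonZero⁻¹ (c * m) {{ℕ.m*n≢0 c m}} ,
    solution⇐ (n∣m*n c) (Equivalence.from (order (c * m)) (m∣m*n m)) ,
    shorter-is-not-solution
    where
    shorter-is-not-solution : ∀ L → 1 ≤ L → L < c * m → ¬ Solution (n * m) (replicate L K)
    shorter-is-not-solution L 1≤L L<cm sol with solution⇒ L sol
    ... | m∣L , A₁^L≅Id = ℕ.<⇒≱ L<cm (∣⇒≤ {{>-nonZero 1≤L}}
      (coprime⇒*∣ c⊥m (Equivalence.to (order L) A₁^L≅Id) m∣L))

  bordered-solution : ∀ {c j} → OrderA₁ n c → c ∣ j → m ∣ suc j →
                      Solution (n * m) (bordered (+ 2 ℤ.- K) (suc j) K)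
  bordered-solution {c} {j} order c∣j m∣s = inj₂ (≅ᴹ⇒≡M (≅ᴹ-combine n⊥m mod-n′ mod-m′))
    where
    f = + 2 ℤ.- K
    mod-n′ : M (bordered f (suc j) K) ≅ᴹ negM IdM [mod n ]
    mod-n′ = begin
      M (bordered f (suc j) K)    ≈⟨ M-cong (bordered-cong (suc j) (+-cong (≅-refl {x = + 2}) (-‿cong k≅1)) k≅1) ⟩
      M (bordered 1ℤ (suc j) 1ℤ) ≡⟨ cong M (bordered-replicate (suc j) 1ℤ) ⟩
      M (replicate (3 + j) 1ℤ)   ≡⟨ M-replicate-1 (3 + j) ⟩
      A₁^ (3 + j)                 ≈⟨ order⇒A₁^3+≅-Id order c∣j ⟩
      negM IdM                    ∎
      where open SetoidReasoning ≅ᴹ-setoid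
    mod-m′ : M (bordered f (suc j) K) ≅ᴹ negM IdM [mod m ]
    mod-m′ = begin
      M (bordered f (suc j) K)                  ≈⟨ M-cong (bordered-cong (suc j) (+-cong (≅-refl {x = + 2}) (-‿cong k≅2)) k≅2) ⟩
      M (bordered 0ℤ (suc j) (+ 2))             ≡⟨ M-bordered 0ℤ (suc j) (+ 2) ⟩
      (A 0ℤ · M (replicate (suc j) (+ 2))) · A 0ℤ ≡⟨ cong (λ X → (A 0ℤ · X) · A 0ℤ) (M-replicate-2 (suc j)) ⟩
      (A 0ℤ · A₂-power (+ suc j)) · A 0ℤ        ≈⟨ ·-congʳ (A 0ℤ) (·-congˡ (A 0ℤ) (A₂-power≅Id m∣s)) ⟩
      (A 0ℤ · IdM) · A 0ℤ                       ≡⟨⟩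
      negM IdM                                  ∎
      where open SetoidReasoning ≅ᴹ-setoid

  minimal-and-reducible : ∀ {c} .{{_ : NonZero c}} → OrderA₁ n c → Coprime c m →
    ∀ j → c ∣ j → m ∣ suc j → j + 4 ≤ c * m →
    IsMonomialMinimalSize (n * m) k (c * m) × Reducible (n * m) (replicate (c * m) K)
  minimal-and-reducible order c⊥m j c∣j m∣s j+4≤cm = minimal ,
    reducible-if-bordered (+ 2 ℤ.- K) j j+4≤cm (proj₁ (proj₂ minimal)) (bordered-solution order c∣j m∣s)
    where
    minimal = monomial-minimal-size order c⊥m

ℕ⇒ℤ-1+ab≡cd : ∀ a b c d → 1 + a * b ≡ c * d → 1ℤ ℤ.+ + a ℤ.* + b ≡ + c ℤ.* + d
ℕ⇒ℤ-1+ab≡cd a b c d eq = begin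
  1ℤ ℤ.+ + a ℤ.* + b ≡⟨ cong (λ z → 1ℤ ℤ.+ z) (ℤ.pos-* a b) ⟨
  1ℤ ℤ.+ + (a * b)    ≡⟨ ℤ.pos-+ 1 (a * b) ⟨
  + (1 + a * b)       ≡⟨ cong +_ eq ⟩
  + (c * d)           ≡⟨ ℤ.pos-* c d ⟩
  + c ℤ.* + d         ∎
  where open ≡-Reasoning

bézout : ∀ {n m} → Coprime n m → ∃[ u ] ∃[ v ] u ℤ.* + n ℤ.+ v ℤ.* + m ≡ 1ℤ
bézout {n} {m} n⊥m with coprime-Bézout n⊥m
... | Bézout.+- x y eq = + x , - + y , (begin
  + x ℤ.* + n ℤ.+ - + y ℤ.* + m          ≡⟨ cong (λ z → z ℤ.+ - + y ℤ.* + m) (ℕ⇒ℤ-1+ab≡cd y m x n eq) ⟨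
  1ℤ ℤ.+ + y ℤ.* + m ℤ.+ - + y ℤ.* + m ≡⟨ cancel (+ y) (+ m) ⟩
  1ℤ                                     ∎)
  where
  open ≡-Reasoning
  cancel : ∀ y m → 1ℤ ℤ.+ y ℤ.* m ℤ.+ - y ℤ.* m ≡ 1ℤ
  cancel = solve-∀
... | Bézout.-+ x y eq = - + x , + y , (begin
  - + x ℤ.* + n ℤ.+ + y ℤ.* + m          ≡⟨ cong (λ z → - + x ℤ.* + n ℤ.+ z) (ℕ⇒ℤ-1+ab≡cd x n y m eq) ⟨
  - + x ℤ.* + n ℤ.+ (1ℤ ℤ.+ + x ℤ.* + n) ≡⟨ cancel (+ x) (+ n) ⟩
  1ℤ                                     ∎)
  where
  open ≡-Reasoning
  cancel : ∀ x n → - x ℤ.* n ℤ.+ (1ℤ ℤ.+ x ℤ.* n) ≡ 1ℤ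
  cancel = solve-∀

%ℕ-≅ : ∀ x N .{{_ : NonZero N}} → + (x %ℕ N) ≅ x [mod N ]
%ℕ-≅ x N = ≅-by _ (begin
  + (x %ℕ N) ℤ.- x                              ≡⟨ cong (λ z → + (x %ℕ N) ℤ.- z) (a≡a%ℕn+[a/ℕn]*n x N) ⟩
  + (x %ℕ N) ℤ.- (+ (x %ℕ N) ℤ.+ q ℤ.* + N)    ≡⟨ cancel (+ (x %ℕ N)) q (+ N) ⟩
  - q ℤ.* + N                                   ∎)
  (ℤ∣.∣n⇒∣m*n (- q) ℤ∣.∣-refl)
  where
  open ≡-Reasoning
  q = x /ℕ N
  cancel : ∀ r q N → r ℤ.- (r ℤ.+ q ℤ.* N) ≡ - q ℤ.* N
  cancel = solve-∀

chinese-remainder : ∀ {n m} .{{_ : NonZero (n * m)}} → Coprime n m → ∀ a b →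
  ∃[ k ] (k < n * m × + k ≅ a [mod n ] × + k ≅ b [mod m ])
chinese-remainder {n} {m} n⊥m a b with bézout n⊥m
... | u , v , un+vm≡1 = x %ℕ (n * m) , n%ℕd<d x (n * m) ,
  ≅-trans (≅-divisor (m∣m*n m) (%ℕ-≅ x (n * m))) (≅-by _ x-a (ℤ∣.∣n⇒∣m*n ((b ℤ.- a) ℤ.* u) ℤ∣.∣-refl)) ,
  ≅-trans (≅-divisor (n∣m*n n) (%ℕ-≅ x (n * m))) (≅-by _ x-b (ℤ∣.∣n⇒∣m*n ((a ℤ.- b) ℤ.* v) ℤ∣.∣-refl))
  where
  open ≡-Reasoning
  x = a ℤ.* v ℤ.* + m ℤ.+ b ℤ.* u ℤ.* + n
  x-a : x ℤ.- a ≡ (b ℤ.- a) ℤ.* u ℤ.* + n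
  x-a = begin
    x ℤ.- a                                           ≡⟨ cong (λ z → x ℤ.- z) (ℤ.*-identityʳ a) ⟨
    x ℤ.- a ℤ.* 1ℤ                                    ≡⟨ cong (λ z → x ℤ.- a ℤ.* z) un+vm≡1 ⟨
    x ℤ.- a ℤ.* (u ℤ.* + n ℤ.+ v ℤ.* + m)              ≡⟨ expand a b u v (+ n) (+ m) ⟩
    (b ℤ.- a) ℤ.* u ℤ.* + n                           ∎
    where
    expand : ∀ a b u v n m →
      a ℤ.* v ℤ.* m ℤ.+ b ℤ.* u ℤ.* n ℤ.- a ℤ.* (u ℤ.* n ℤ.+ v ℤ.* m) ≡ (b ℤ.- a) ℤ.* u ℤ.* n
    expand = solve-∀
  x-b : x ℤ.- b ≡ (a ℤ.- b) ℤ.* v ℤ.* + m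
  x-b = begin
    x ℤ.- b                                           ≡⟨ cong (λ z → x ℤ.- z) (ℤ.*-identityʳ b) ⟨
    x ℤ.- b ℤ.* 1ℤ                                    ≡⟨ cong (λ z → x ℤ.- b ℤ.* z) un+vm≡1 ⟨
    x ℤ.- b ℤ.* (u ℤ.* + n ℤ.+ v ℤ.* + m)              ≡⟨ expand a b u v (+ n) (+ m) ⟩
    (a ℤ.- b) ℤ.* v ℤ.* + m                           ∎
    where
    expand : ∀ a b u v n m →
      a ℤ.* v ℤ.* m ℤ.+ b ℤ.* u ℤ.* n ℤ.- b ℤ.* (u ℤ.* n ℤ.+ v ℤ.* m) ≡ (a ℤ.- b) ℤ.* v ℤ.* m
    expand = solve-∀

coprime-if-≅ : ∀ {N k a} → + k ≅ + a [mod N ] → Coprime a N → Coprime k N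
coprime-if-≅ {N} {k} {a} (modulo N∣k-a) a⊥N {d} (d∣k , d∣N) =
  a⊥N (∣⇒∣ᵤ (subst (+ d ∣ℤ_) (k-[k-a]≡a (+ k) (+ a)) d∣k-[k-a]) , d∣N)
  where
  d∣k-[k-a] : + d ∣ℤ + k ℤ.- (+ k ℤ.- + a)
  d∣k-[k-a] = ℤ∣.∣m∣n⇒∣m-n (∣ᵤ⇒∣ {+ d} {+ k} d∣k) (ℤ∣.∣-trans (∣ᵤ⇒∣ {+ d} {+ N} d∣N) N∣k-a)
  k-[k-a]≡a : ∀ k a → k ℤ.- (k ℤ.- a) ≡ a
  k-[k-a]≡a = solve-∀

coprime-* : ∀ {k n m} → Coprime k n → Coprime k m → Coprime k (n * m)
coprime-* {k} {n} {m} k⊥n k⊥m {d} (d∣k , d∣nm) = k⊥m (d∣k , coprime-divisor d⊥n d∣nm)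
  where
  d⊥n : Coprime d n
  d⊥n (e∣d , e∣n) = k⊥n (∣-trans e∣d d∣k , e∣n)

2-coprime-odd : ∀ {m} → ¬ 2 ∣ m → Coprime 2 m
2-coprime-odd 2∤m {d} (d∣2 , d∣m) with prime⇒irreducible prime[2] d∣2
... | inj₁ d≡1  = d≡1
... | inj₂ refl = ⊥-elim (2∤m d∣m)

_≡±1[mod_] : ℕ → ℕ → Set
m ≡±1[mod c ] = (∃[ q ] m ≡ q * c + 1) ⊎ (∃[ q ] m + 1 ≡ q * c)

≡±1[mod6] : ∀ {m} → ¬ 2 ∣ m → ¬ 3 ∣ m → m ≡±1[mod 6 ]
≡±1[mod6] {m} 2∤m 3∤m = by-residue (m % 6) (m%n<n m 6) (m≡m%n+[m/n]*n m 6)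
  where
  q = m / 6
  by-residue : ∀ r → r < 6 → m ≡ r + q * 6 → m ≡±1[mod 6 ]
  by-residue 0 _ m≡ = ⊥-elim (2∤m (divides (q * 3) (trans m≡ (e q))))
    where
    e : ∀ q → 0 + q * 6 ≡ q * 3 * 2
    e = ℕ-Solver.solve-∀
  by-residue 1 _ m≡ = inj₁ (q , trans m≡ (ℕ.+-comm 1 (q * 6)))
  by-residue 2 _ m≡ = ⊥-elim (2∤m (divides (1 + q * 3) (trans m≡ (e q))))
    where
    e : ∀ q → 2 + q * 6 ≡ (1 + q * 3) * 2
    e = ℕ-Solver.solve-∀
  by-residue 3 _ m≡ = ⊥-elim (3∤m (divides (1 + q * 2) (trans m≡ (e q))))
    where
    e : ∀ q → 3 + q * 6 ≡ (1 + q * 2) * 3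
    e = ℕ-Solver.solve-∀
  by-residue 4 _ m≡ = ⊥-elim (2∤m (divides (2 + q * 3) (trans m≡ (e q))))
    where
    e : ∀ q → 4 + q * 6 ≡ (2 + q * 3) * 2
    e = ℕ-Solver.solve-∀
  by-residue 5 _ m≡ = inj₂ (suc q , trans (cong (_+ 1) m≡) (e q))
    where
    e : ∀ q → 5 + q * 6 + 1 ≡ suc q * 6
    e = ℕ-Solver.solve-∀
  by-residue (suc (suc (suc (suc (suc (suc _)))))) (s≤s (s≤s (s≤s (s≤s (s≤s (s≤s ())))))) _

≡±1[mod6]⇒[mod3] : ∀ {m} → m ≡±1[mod 6 ] → m ≡±1[mod 3 ]
≡±1[mod6]⇒[mod3] (inj₁ (q , m≡)) = inj₁ (q * 2 , trans m≡ (cong (_+ 1) (sym (ℕ.*-assoc q 2 3))))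
≡±1[mod6]⇒[mod3] (inj₂ (q , m≡)) = inj₂ (q * 2 , trans m≡ (sym (ℕ.*-assoc q 2 3)))

≡±1⇒coprime : ∀ {m c} → m ≡±1[mod c ] → Coprime c m
≡±1⇒coprime {m} {c} (inj₁ (q , m≡qc+1)) {d} (d∣c , d∣m) =
  ∣1⇒≡1 (∣m+n∣m⇒∣n (subst (d ∣_) m≡qc+1 d∣m) (∣-trans d∣c (n∣m*n q)))
≡±1⇒coprime {m} {c} (inj₂ (q , m+1≡qc)) {d} (d∣c , d∣m) =
  ∣1⇒≡1 (∣m+n∣m⇒∣n (subst (d ∣_) (sym m+1≡qc) (∣-trans d∣c (n∣m*n q))) d∣m)

m+3≤c*m : ∀ {c m} → 2 ≤ c → 3 ≤ m → m + 3 ≤ c * m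
m+3≤c*m {c} {m} 2≤c 3≤m = begin
  m + 3       ≤⟨ ℕ.+-monoʳ-≤ m 3≤m ⟩
  m + m       ≡⟨ cong (λ x → m + x) (ℕ.+-identityʳ m) ⟨
  2 * m       ≤⟨ ℕ.*-monoˡ-≤ m 2≤c ⟩
  c * m       ∎
  where open ℕ.≤-Reasoning

-- j + 1 is m times the inverse ±1 of m modulo c, that is m or (c - 1) m.
≡±1⇒multiple≡1 : ∀ {c m} → 2 ≤ c → 3 ≤ m → m ≡±1[mod c ] → ∃[ j ] (c ∣ j × m ∣ suc j × j + 4 ≤ c * m)
≡±1⇒multiple≡1 {c} {m} 2≤c 3≤m (inj₁ (q , m≡qc+1)) =
  q * c , divides q refl , ∣-reflexive (trans m≡qc+1 (ℕ.+-comm (q * c) 1)) ,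
  subst (_≤ c * m) (trans (cong (_+ 3) m≡qc+1) (ℕ.+-assoc (q * c) 1 3)) (m+3≤c*m 2≤c 3≤m)
≡±1⇒multiple≡1 {c} {m} 2≤c 3≤m (inj₂ (q , m+1≡qc)) with q | trans (ℕ.+-comm 1 m) m+1≡qc | 2≤c
... | zero  | ()     | _
... | suc p | 1+m≡qc | s≤s (s≤s {n = d} z≤n) with ℕ.suc-injective 1+m≡qc
...   | refl =
  c * (suc d * p + d) , divides (suc d * p + d) (ℕ.*-comm c (suc d * p + d)) , divides (suc d) (inverse d p) ,
  subst (_≤ c * m) (sym (j+4 d p))
    (subst (suc d * m + 3 ≤_) (ℕ.+-comm (suc d * m) m) (ℕ.+-monoʳ-≤ (suc d * m) 3≤m))
  where
  inverse : ∀ d p → suc ((2 + d) * ((1 + d) * p + d)) ≡ (1 + d) * (suc d + p * (2 + d))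
  inverse = ℕ-Solver.solve-∀
  j+4 : ∀ d p → (2 + d) * ((1 + d) * p + d) + 4 ≡ (1 + d) * (suc d + p * (2 + d)) + 3
  j+4 = ℕ-Solver.solve-∀

≅1⇒1≤ : ∀ {n k} → 1 < n → + k ≅ 1ℤ [mod n ] → 1 ≤ k
≅1⇒1≤ {k = zero}  1<n k≅1 = ⊥-elim (ℕ.<⇒≱ 1<n (∣⇒≤ (≅⇒≡[mod] k≅1)))
≅1⇒1≤ {k = suc _} _   _   = s≤s z≤n

odd∧≢1⇒3≤ : ∀ {m} → m ≢ 1 → ¬ 2 ∣ m → 3 ≤ m
odd∧≢1⇒3≤ {0}                 _   2∤m = ⊥-elim (2∤m (2 ∣0))
odd∧≢1⇒3≤ {1}                 m≢1 _   = ⊥-elim (m≢1 refl)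
odd∧≢1⇒3≤ {2}                 _   2∤m = ⊥-elim (2∤m ∣-refl)
odd∧≢1⇒3≤ {suc (suc (suc _))} _   _   = s≤s (s≤s (s≤s z≤n))

monomial-witness : ∀ {n m c} .{{_ : NonZero c}} → 1 < n → Coprime n m → ¬ 2 ∣ m → 3 ≤ m →
  OrderA₁ n c → 2 ≤ c → m ≡±1[mod c ] →
  ∃[ k ] (1 ≤ k × k < n * m × Coprime k (n * m) ×
          IsMonomialMinimalSize (n * m) k (c * m) × Reducible (n * m) (replicate (c * m) (+ k)))
monomial-witness {n} {m} 1<n n⊥m 2∤m 3≤m order 2≤c m≡±1 =
  let k , k<nm , k≅1 , k≅2 = chinese-remainder n⊥m 1ℤ (+ 2)
      j , c∣j , m∣1+j , j+4≤cm = ≡±1⇒multiple≡1 2≤c 3≤m m≡±1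
      open MonomialSolutions n⊥m 3≤m k≅1 k≅2
  in k , ≅1⇒1≤ 1<n k≅1 , k<nm ,
     coprime-* (coprime-if-≅ k≅1 (1-coprimeTo n)) (coprime-if-≅ k≅2 (2-coprime-odd 2∤m)) ,
     minimal-and-reducible order (≡±1⇒coprime m≡±1) j c∣j m∣1+j j+4≤cm
  where
  instance
    nm≢0 : NonZero (n * m)
    nm≢0 = ℕ.m*n≢0 n m {{>-nonZero (ℕ.<-trans (s≤s z≤n) 1<n)}} {{>-nonZero (ℕ.≤-trans (s≤s z≤n) 3≤m)}}

proposition3p7 : (n m : ℕ) → Coprime n m → n ≢ 1 → m ≢ 1 → ¬ (2 ∣ m) → ¬ (3 ∣ m) →
  ∃[ k ] ∃[ L ] (1 ≤ k × k < n * m × Coprime k (n * m) ×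
    IsMonomialMinimalSize (n * m) k L ×
    Reducible (n * m) (replicate L (+ k)) ×
    ((n > 2 → L ≡ 6 * m) × (n ≤ 2 → L ≡ 3 * m)))
proposition3p7 0 m n⊥m _ m≢1 _ _ = ⊥-elim (m≢1 (n⊥m (m ∣0 , ∣-refl)))
proposition3p7 1 _ _ n≢1 _ _ _ = ⊥-elim (n≢1 refl)
proposition3p7 2 m n⊥m _ m≢1 2∤m 3∤m =
  let k , 1≤k , k<nm , k⊥nm , minimal , reducible =
        monomial-witness (s≤s (s≤s z≤n)) n⊥m 2∤m (odd∧≢1⇒3≤ m≢1 2∤m)
          order-3-mod-2 (s≤s (s≤s z≤n)) (≡±1[mod6]⇒[mod3] (≡±1[mod6] 2∤m 3∤m))
  in k , 3 * m , 1≤k , k<nm , k⊥nm , minimal , reducible ,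
     (λ 2>2 → ⊥-elim (ℕ.<-irrefl refl 2>2)) , (λ _ → refl)
proposition3p7 n@(suc (suc (suc _))) m n⊥m _ m≢1 2∤m 3∤m =
  let k , 1≤k , k<nm , k⊥nm , minimal , reducible =
        monomial-witness (s≤s (s≤s z≤n)) n⊥m 2∤m (odd∧≢1⇒3≤ m≢1 2∤m)
          (order-6 n∤2) (s≤s (s≤s z≤n)) (≡±1[mod6] 2∤m 3∤m)
  in k , 6 * m , 1≤k , k<nm , k⊥nm , minimal , reducible ,
     (λ _ → refl) , (λ n≤2 → ⊥-elim (ℕ.<⇒≱ 2<n n≤2))
  where
  2<n : 2 < n
  2<n = s≤s (s≤s (s≤s z≤n))
  n∤2 : ¬ n ∣ 2
  n∤2 n∣2 = ℕ.<⇒≱ 2<n (∣⇒≤ n∣2)
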